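{- (i) For all integers $x_1,x_2,x_3$, the integers $$a=-x_1^2+x_2^2+x_3^2-2x_1x_2-2x_1x_3,\quad b=x_1^2-x_2^2+x_3^2-2x_1x_2-2x_2x_3,$$ $$c=x_1^2+x_2^2-x_3^2-2x_3x_1-2x_3x_2,\quad d=x_1^2+x_2^2+x_3^2$$ satisfy $a^2+b^2+c^2=3d^2$. (ii) Let $a,b,c,d$ be positive integers with $a^2+b^2+c^2=3d^2$, $\gcd(a,b,c)=1$ and $a\le b\le c$. Then there exist a nonnegative integer $k$ and real numbers $x_1,x_2,x_3\in\mathbb{Q}\sqrt{k}=\{t\sqrt{k}: t\in\mathbb{Q}\}$ such that $a,b,c,d$ are given by the four formulas in (i). -}

module Defs where

open import Data.Nat using (ℕ)
open import Data.Integer as Int using (ℤ; +_)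
open import Data.Rational as Rat using (ℚ)

module IntForms where
  open Int using (_+_; _-_; _*_; -_)
  A B C D : ℤ → ℤ → ℤ → ℤ
  A x₁ x₂ x₃ = - (x₁ * x₁) + x₂ * x₂ + x₃ * x₃ - + 2 * x₁ * x₂ - + 2 * x₁ * x₃
  B x₁ x₂ x₃ = x₁ * x₁ - x₂ * x₂ + x₃ * x₃ - + 2 * x₁ * x₂ - + 2 * x₂ * x₃
  C x₁ x₂ x₃ = x₁ * x₁ + x₂ * x₂ - x₃ * x₃ - + 2 * x₃ * x₁ - + 2 * x₃ * x₂
  D x₁ x₂ x₃ = x₁ * x₁ + x₂ * x₂ + x₃ * x₃

module RatForms where
  open Rat using (_+_; _-_; _*_; -_; _/_)
  two : ℚ
  two = (+ 2) Rat./ 1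
  A B C D : ℚ → ℚ → ℚ → ℚ
  A x₁ x₂ x₃ = - (x₁ * x₁) + x₂ * x₂ + x₃ * x₃ - two * x₁ * x₂ - two * x₁ * x₃
  B x₁ x₂ x₃ = x₁ * x₁ - x₂ * x₂ + x₃ * x₃ - two * x₁ * x₂ - two * x₂ * x₃
  C x₁ x₂ x₃ = x₁ * x₁ + x₂ * x₂ - x₃ * x₃ - two * x₃ * x₁ - two * x₃ * x₂
  D x₁ x₂ x₃ = x₁ * x₁ + x₂ * x₂ + x₃ * x₃

ℕ→ℚ : ℕ → ℚ
ℕ→ℚ n = (+ n) Rat./ 1

{-# OPTIONS --safe #-}
module Submission where

-- With S = x₁ + x₂ + x₃ the forms are A = D - 2x₁S, B = D - 2x₂S, C = D - 2x₃S, so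
-- A² + B² + C² = 3D² - 4DS·S + 4S²·D = 3D², which is (i).
--
-- Put xᵢ = d - aᵢ (a₁ = a, a₂ = b, a₃ = c), so that S(x) = 3d - a - b - c =: s.
-- On the quadric a² + b² + c² = 3d² one has D(x) = 2ds, hence A(x) = 2sa, B(x) = 2sb, C(x) = 2sc;
-- so k = 2s and tᵢ = xᵢ/(2s) work as soon as s > 0. For naturals s ≥ 0 always, because
-- Σ (aᵢ - d)² = 2ds with d > 0, and s = 0 forces a = b = c = d, where k = 2d, t = (½, -½, 0) work.

open import Defs
open import Data.Product using (_×_; ∃; ∃-syntax; _,_)
open import Data.Nat as Nat using (ℕ; _≤_; _<_)
open import Data.Nat.GCD using (gcd)
open import Data.Integer as Int using (ℤ; +_)
open import Data.Rational as Rat using (ℚ)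
open import Data.Sum using (inj₁; inj₂)
open import Relation.Binary.PropositionalEquality
  using (_≡_; refl; sym; trans; cong; cong₂; module ≡-Reasoning)

module _ where
  open Int using (_+_; _*_)
  open import Data.Integer.Solver using (module +-*-Solver)
  open +-*-Solver

  A²+B²+C²≡3D² : ∀ (x₁ x₂ x₃ : ℤ) →
    IntForms.A x₁ x₂ x₃ * IntForms.A x₁ x₂ x₃
      + IntForms.B x₁ x₂ x₃ * IntForms.B x₁ x₂ x₃
      + IntForms.C x₁ x₂ x₃ * IntForms.C x₁ x₂ x₃
      ≡ + 3 * (IntForms.D x₁ x₂ x₃ * IntForms.D x₁ x₂ x₃)
  A²+B²+C²≡3D² = solve 3 (λ x₁ x₂ x₃ →
    let two = con (+ 2)
        A = :- (x₁ :* x₁) :+ x₂ :* x₂ :+ x₃ :* x₃ :- two :* x₁ :* x₂ :- two :* x₁ :* x₃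
        B = x₁ :* x₁ :- x₂ :* x₂ :+ x₃ :* x₃ :- two :* x₁ :* x₂ :- two :* x₂ :* x₃
        C = x₁ :* x₁ :+ x₂ :* x₂ :- x₃ :* x₃ :- two :* x₃ :* x₁ :- two :* x₃ :* x₂
        D = x₁ :* x₁ :+ x₂ :* x₂ :+ x₃ :* x₃
    in A :* A :+ B :* B :+ C :* C := con (+ 3) :* (D :* D)) refl

module _ where
  open Nat using (suc; _+_; _*_; ∣_-_∣)
  open import Data.Nat.Properties
    using (≤-total; m≤n⇒∃[o]m+o≡n; ∣m-m+n∣≡n; ∣-∣-comm; *-comm; +-comm; m*n≡0⇒m≡0∨n≡0;
           ∣m-n∣≡0⇒m≡n; m+n≡0⇒m≡0; m+n≡0⇒n≡0; *-cancelˡ-≤; m≤n+m; +-cancelʳ-≡;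
           module ≤-Reasoning)
  open import Data.Nat.Tactic.RingSolver using (solve-∀)

  m≤n⇒∣m-n∣²+2mn≡m²+n² : ∀ {m n} → m ≤ n →
                         ∣ m - n ∣ * ∣ m - n ∣ + 2 * (m * n) ≡ m * m + n * n
  m≤n⇒∣m-n∣²+2mn≡m²+n² {m} m≤n with m≤n⇒∃[o]m+o≡n m≤n
  ... | o , refl rewrite ∣m-m+n∣≡n m o = expand m o
    where
    expand : ∀ m o → o * o + 2 * (m * (m + o)) ≡ m * m + (m + o) * (m + o)
    expand = solve-∀

  ∣m-n∣²+2mn≡m²+n² : ∀ m n → ∣ m - n ∣ * ∣ m - n ∣ + 2 * (m * n) ≡ m * m + n * n
  ∣m-n∣²+2mn≡m²+n² m n with ≤-total m n
  ... | inj₁ m≤n = m≤n⇒∣m-n∣²+2mn≡m²+n² m≤n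
  ... | inj₂ n≤m = begin
    ∣ m - n ∣ * ∣ m - n ∣ + 2 * (m * n)
      ≡⟨ cong₂ (λ e p → e * e + 2 * p) (∣-∣-comm m n) (*-comm m n) ⟩
    ∣ n - m ∣ * ∣ n - m ∣ + 2 * (n * m) ≡⟨ m≤n⇒∣m-n∣²+2mn≡m²+n² n≤m ⟩
    n * n + m * m                       ≡⟨ +-comm (n * n) (m * m) ⟩
    m * m + n * n                       ∎
    where open ≡-Reasoning

  ∣m-n∣²≡0⇒m≡n : ∀ {m n} → ∣ m - n ∣ * ∣ m - n ∣ ≡ 0 → m ≡ n
  ∣m-n∣²≡0⇒m≡n {m} {n} e with m*n≡0⇒m≡0∨n≡0 ∣ m - n ∣ e
  ... | inj₁ ∣m-n∣≡0 = ∣m-n∣≡0⇒m≡n ∣m-n∣≡0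
  ... | inj₂ ∣m-n∣≡0 = ∣m-n∣≡0⇒m≡n ∣m-n∣≡0

  sqDist : ℕ → ℕ → ℕ → ℕ → ℕ
  sqDist a b c d = ∣ a - d ∣ * ∣ a - d ∣ + ∣ b - d ∣ * ∣ b - d ∣ + ∣ c - d ∣ * ∣ c - d ∣

  sqDist≡0⇒a≡b≡c≡d : ∀ {a b c d} → sqDist a b c d ≡ 0 → a ≡ d × b ≡ d × c ≡ d
  sqDist≡0⇒a≡b≡c≡d {a} {b} {c} {d} e =
    ∣m-n∣²≡0⇒m≡n (m+n≡0⇒m≡0 ∣a-d∣² (m+n≡0⇒m≡0 (∣a-d∣² + ∣b-d∣²) e)) ,
    ∣m-n∣²≡0⇒m≡n (m+n≡0⇒n≡0 ∣a-d∣² (m+n≡0⇒m≡0 (∣a-d∣² + ∣b-d∣²) e)) ,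
    ∣m-n∣²≡0⇒m≡n (m+n≡0⇒n≡0 (∣a-d∣² + ∣b-d∣²) e)
    where
    ∣a-d∣² ∣b-d∣² : ℕ
    ∣a-d∣² = ∣ a - d ∣ * ∣ a - d ∣
    ∣b-d∣² = ∣ b - d ∣ * ∣ b - d ∣

  sqDist+2d[a+b+c]≡2d[3d] : ∀ a b c d → a * a + b * b + c * c ≡ 3 * (d * d) →
                            sqDist a b c d + 2 * d * (a + b + c) ≡ 2 * d * (3 * d)
  sqDist+2d[a+b+c]≡2d[3d] a b c d onQuadric = begin
    sqDist a b c d + 2 * d * (a + b + c)
      ≡⟨ regroup ∣ a - d ∣ ∣ b - d ∣ ∣ c - d ∣ a b c d ⟩
    (∣ a - d ∣ * ∣ a - d ∣ + 2 * (a * d)) + (∣ b - d ∣ * ∣ b - d ∣ + 2 * (b * d))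
      + (∣ c - d ∣ * ∣ c - d ∣ + 2 * (c * d))
      ≡⟨ cong₂ _+_ (cong₂ _+_ (∣m-n∣²+2mn≡m²+n² a d) (∣m-n∣²+2mn≡m²+n² b d))
                   (∣m-n∣²+2mn≡m²+n² c d) ⟩
    (a * a + d * d) + (b * b + d * d) + (c * c + d * d)
      ≡⟨ collect a b c d ⟩
    (a * a + b * b + c * c) + 3 * (d * d)
      ≡⟨ cong (_+ 3 * (d * d)) onQuadric ⟩
    3 * (d * d) + 3 * (d * d)
      ≡⟨ double d ⟩
    2 * d * (3 * d) ∎
    where
    open ≡-Reasoning
    regroup : ∀ x y z a b c d → x * x + y * y + z * z + 2 * d * (a + b + c)
              ≡ (x * x + 2 * (a * d)) + (y * y + 2 * (b * d)) + (z * z + 2 * (c * d))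
    regroup = solve-∀
    collect : ∀ a b c d → (a * a + d * d) + (b * b + d * d) + (c * c + d * d)
              ≡ (a * a + b * b + c * c) + 3 * (d * d)
    collect = solve-∀
    double : ∀ d → 3 * (d * d) + 3 * (d * d) ≡ 2 * d * (3 * d)
    double = solve-∀

  a+b+c≤3d : ∀ a b c d → 0 < d → a * a + b * b + c * c ≡ 3 * (d * d) → a + b + c ≤ 3 * d
  a+b+c≤3d a b c d@(suc _) _ onQuadric = *-cancelˡ-≤ (2 * d) (begin
    2 * d * (a + b + c)                  ≤⟨ m≤n+m _ (sqDist a b c d) ⟩
    sqDist a b c d + 2 * d * (a + b + c) ≡⟨ sqDist+2d[a+b+c]≡2d[3d] a b c d onQuadric ⟩
    2 * d * (3 * d)                      ∎)
    where open ≤-Reasoning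

  a+b+c≡3d⇒a≡b≡c≡d : ∀ a b c d → a * a + b * b + c * c ≡ 3 * (d * d) → a + b + c ≡ 3 * d →
                     a ≡ d × b ≡ d × c ≡ d
  a+b+c≡3d⇒a≡b≡c≡d a b c d onQuadric a+b+c≡3d =
    sqDist≡0⇒a≡b≡c≡d (+-cancelʳ-≡ _ _ 0 (begin
    sqDist a b c d + 2 * d * (a + b + c) ≡⟨ sqDist+2d[a+b+c]≡2d[3d] a b c d onQuadric ⟩
    2 * d * (3 * d)                      ≡⟨ cong (2 * d *_) a+b+c≡3d ⟨
    2 * d * (a + b + c)                  ∎))
    where open ≡-Reasoning

module _ where
  open Rat using (_+_; _-_; _*_; 0ℚ; 1ℚ; ½; -½; toℚᵘ; NonZero)
  open import Data.Rational.Properties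
    using (toℚᵘ-injective; toℚᵘ-fromℚᵘ; toℚᵘ-homo-+; toℚᵘ-homo-*; +-inverseʳ; *-inverseʳ;
           pos⇒nonZero; normalize-pos)
  open import Data.Rational.Unnormalised as ℚᵘ using (mkℚᵘ; *≡*) renaming (_≃_ to _≃ᵘ_)
  import Data.Rational.Unnormalised.Properties as ℚᵘ
  import Data.Integer.Properties as Int
  open import Data.Nat.Properties using (m≤n⇒∃[o]m+o≡n; +-identityʳ)
  open import Data.Rational.Solver using (module +-*-Solver)
  open +-*-Solver
  open RatForms using (two)

  toℚᵘ-ℕ→ℚ : ∀ n → toℚᵘ (ℕ→ℚ n) ≃ᵘ mkℚᵘ (+ n) 0
  toℚᵘ-ℕ→ℚ n = toℚᵘ-fromℚᵘ (mkℚᵘ (+ n) 0)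

  ℕ→ℚ-+ : ∀ m n → ℕ→ℚ (m Nat.+ n) ≡ ℕ→ℚ m + ℕ→ℚ n
  ℕ→ℚ-+ m n = toℚᵘ-injective (begin-equality
    toℚᵘ (ℕ→ℚ (m Nat.+ n))         ≃⟨ toℚᵘ-ℕ→ℚ (m Nat.+ n) ⟩
    mkℚᵘ (+ (m Nat.+ n)) 0           ≃⟨ *≡* (cong (Int._* + 1) +[m+n]≡+m*1++n*1) ⟩
    mkℚᵘ (+ m) 0 ℚᵘ.+ mkℚᵘ (+ n) 0   ≃⟨ ℚᵘ.+-cong (toℚᵘ-ℕ→ℚ m) (toℚᵘ-ℕ→ℚ n) ⟨
    toℚᵘ (ℕ→ℚ m) ℚᵘ.+ toℚᵘ (ℕ→ℚ n)   ≃⟨ toℚᵘ-homo-+ (ℕ→ℚ m) (ℕ→ℚ n) ⟨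
    toℚᵘ (ℕ→ℚ m + ℕ→ℚ n)            ∎)
    where
    open ℚᵘ.≤-Reasoning
    +[m+n]≡+m*1++n*1 : + (m Nat.+ n) ≡ + m Int.* + 1 Int.+ + n Int.* + 1
    +[m+n]≡+m*1++n*1 =
      trans (Int.pos-+ m n) (sym (cong₂ Int._+_ (Int.*-identityʳ (+ m)) (Int.*-identityʳ (+ n))))

  ℕ→ℚ-* : ∀ m n → ℕ→ℚ (m Nat.* n) ≡ ℕ→ℚ m * ℕ→ℚ n
  ℕ→ℚ-* m n = toℚᵘ-injective (begin-equality
    toℚᵘ (ℕ→ℚ (m Nat.* n))         ≃⟨ toℚᵘ-ℕ→ℚ (m Nat.* n) ⟩
    mkℚᵘ (+ (m Nat.* n)) 0           ≃⟨ *≡* (cong (Int._* + 1) (Int.pos-* m n)) ⟩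
    mkℚᵘ (+ m) 0 ℚᵘ.* mkℚᵘ (+ n) 0   ≃⟨ ℚᵘ.*-cong (toℚᵘ-ℕ→ℚ m) (toℚᵘ-ℕ→ℚ n) ⟨
    toℚᵘ (ℕ→ℚ m) ℚᵘ.* toℚᵘ (ℕ→ℚ n)   ≃⟨ toℚᵘ-homo-* (ℕ→ℚ m) (ℕ→ℚ n) ⟨
    toℚᵘ (ℕ→ℚ m * ℕ→ℚ n)            ∎)
    where open ℚᵘ.≤-Reasoning

  ℕ→ℚ-nonZero : ∀ n .{{_ : Nat.NonZero n}} → NonZero (ℕ→ℚ n)
  ℕ→ℚ-nonZero n = pos⇒nonZero (ℕ→ℚ n) {{normalize-pos n 1}}

  three : ℚ
  three = ℕ→ℚ 3

  -- xᵢ = tᵢ√k ∈ ℚ√k gives A(x) = k·A(t), so this is the conclusion of (ii) for the value k.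
  Parametrisable : ℚ → ℚ → ℚ → ℚ → ℚ → Set
  Parametrisable k a b c d = ∃[ t₁ ] ∃[ t₂ ] ∃[ t₃ ]
    (a ≡ k * RatForms.A t₁ t₂ t₃ × b ≡ k * RatForms.B t₁ t₂ t₃ ×
     c ≡ k * RatForms.C t₁ t₂ t₃ × d ≡ k * RatForms.D t₁ t₂ t₃)

  parametrisable-diagonal : ∀ {k q} → k ≡ two * q → Parametrisable k q q q q
  parametrisable-diagonal {q = q} refl = ½ , -½ , 0ℚ , q≡2q½ , q≡2q½ , q≡2q½ , q≡2q½
    where
    q≡2q½ : q ≡ two * q * ½
    q≡2q½ = solve 1 (λ q → q := con two :* q :* con ½) refl q

  private
    Form : ℕ → Set
    Form n = Polynomial n → Polynomial n → Polynomial n → Polynomial n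

    -- RatForms.A, …, RatForms.D verbatim, so that solve returns the equations about them.
    Aᴾ Bᴾ Cᴾ Dᴾ : ∀ {n} → Form n
    Aᴾ x₁ x₂ x₃ = :- (x₁ :* x₁) :+ x₂ :* x₂ :+ x₃ :* x₃ :- con two :* x₁ :* x₂ :- con two :* x₁ :* x₃
    Bᴾ x₁ x₂ x₃ = x₁ :* x₁ :- x₂ :* x₂ :+ x₃ :* x₃ :- con two :* x₁ :* x₂ :- con two :* x₂ :* x₃
    Cᴾ x₁ x₂ x₃ = x₁ :* x₁ :+ x₂ :* x₂ :- x₃ :* x₃ :- con two :* x₃ :* x₁ :- con two :* x₃ :* x₂
    Dᴾ x₁ x₂ x₃ = x₁ :* x₁ :+ x₂ :* x₂ :+ x₃ :* x₃

    -- k·F(t) = (ku)²·f up to multiples of the defects r₁, r₂ of the two hypotheses below.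
    scaling-identity : ∀ {n} → Form n → (f a b c d s u : Polynomial n) → Polynomial n × Polynomial n
    scaling-identity F f a b c d s u =
      k :* F ((d :- a) :* u) ((d :- b) :* u) ((d :- c) :* u)
        := (k :* u) :* (k :* u) :* f :+ k :* u :* u :* (r₁ :- con two :* f :* r₂)
      where
      k  = con two :* s
      r₁ = a :* a :+ b :* b :+ c :* c :- con three :* (d :* d)
      r₂ = a :+ b :+ c :+ s :- con three :* d

  parametrisable-by-deviations : ∀ {k a b c d s u} → k ≡ two * s →
    a * a + b * b + c * c ≡ three * (d * d) → a + b + c + s ≡ three * d → k * u ≡ 1ℚ →
    Parametrisable k a b c d
  parametrisable-by-deviations {a = a} {b} {c} {d} {s} {u} refl onQuadric a+b+c+s≡3d ku≡1 =
    (d - a) * u , (d - b) * u , (d - c) * u ,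
    collapse (solve 6 (λ a b c d s u → scaling-identity Aᴾ a a b c d s u) refl a b c d s u) ,
    collapse (solve 6 (λ a b c d s u → scaling-identity Bᴾ b a b c d s u) refl a b c d s u) ,
    collapse (solve 6 (λ a b c d s u → scaling-identity Cᴾ c a b c d s u) refl a b c d s u) ,
    collapse (solve 6 (λ a b c d s u → scaling-identity Dᴾ d a b c d s u) refl a b c d s u)
    where
    k r₁ r₂ : ℚ
    k  = two * s
    r₁ = a * a + b * b + c * c - three * (d * d)
    r₂ = a + b + c + s - three * d
    r₁≡0 : r₁ ≡ 0ℚ
    r₁≡0 = trans (cong (_- three * (d * d)) onQuadric) (+-inverseʳ (three * (d * d)))
    r₂≡0 : r₂ ≡ 0ℚ
    r₂≡0 = trans (cong (_- three * d) a+b+c+s≡3d) (+-inverseʳ (three * d))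
    collapse : ∀ {f F} → k * F ≡ (k * u) * (k * u) * f + k * u * u * (r₁ - two * f * r₂) →
               f ≡ k * F
    collapse {f} e = sym (trans e (substitute ku≡1 r₁≡0 r₂≡0))
      where
      substitute : ∀ {x p q} → x ≡ 1ℚ → p ≡ 0ℚ → q ≡ 0ℚ →
                   x * x * f + k * u * u * (p - two * f * q) ≡ f
      substitute refl refl refl = solve 2
        (λ y f → con 1ℚ :* con 1ℚ :* f :+ y :* (con 0ℚ :- con two :* f :* con 0ℚ) := f)
        refl (k * u * u) f

  onQuadric⇒parametrisable : ∀ a b c d → 0 < d →
    a Nat.* a Nat.+ b Nat.* b Nat.+ c Nat.* c ≡ 3 Nat.* (d Nat.* d) →
    ∃[ k ] Parametrisable (ℕ→ℚ k) (ℕ→ℚ a) (ℕ→ℚ b) (ℕ→ℚ c) (ℕ→ℚ d)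
  onQuadric⇒parametrisable a b c d 0<d onQuadric
    with m≤n⇒∃[o]m+o≡n (a+b+c≤3d a b c d 0<d onQuadric)
  ... | 0 , a+b+c+0≡3d
    with a+b+c≡3d⇒a≡b≡c≡d a b c d onQuadric
           (trans (sym (+-identityʳ (a Nat.+ b Nat.+ c))) a+b+c+0≡3d)
  ...   | refl , refl , refl = 2 Nat.* d , parametrisable-diagonal (ℕ→ℚ-* 2 d)
  onQuadric⇒parametrisable a b c d 0<d onQuadric | s@(Nat.suc _) , a+b+c+s≡3d =
    2 Nat.* s ,
    parametrisable-by-deviations (ℕ→ℚ-* 2 s) onQuadricℚ a+b+c+s≡3dℚ
      (*-inverseʳ (ℕ→ℚ (2 Nat.* s)) {{ℕ→ℚ-nonZero (2 Nat.* s)}})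
    where
    open ≡-Reasoning
    ℕ→ℚ-+₃ : ∀ x y z → ℕ→ℚ (x Nat.+ y Nat.+ z) ≡ ℕ→ℚ x + ℕ→ℚ y + ℕ→ℚ z
    ℕ→ℚ-+₃ x y z = trans (ℕ→ℚ-+ (x Nat.+ y) z) (cong (_+ ℕ→ℚ z) (ℕ→ℚ-+ x y))
    onQuadricℚ : ℕ→ℚ a * ℕ→ℚ a + ℕ→ℚ b * ℕ→ℚ b + ℕ→ℚ c * ℕ→ℚ c
                 ≡ three * (ℕ→ℚ d * ℕ→ℚ d)
    onQuadricℚ = begin
      ℕ→ℚ a * ℕ→ℚ a + ℕ→ℚ b * ℕ→ℚ b + ℕ→ℚ c * ℕ→ℚ c
        ≡⟨ cong₂ _+_ (cong₂ _+_ (ℕ→ℚ-* a a) (ℕ→ℚ-* b b)) (ℕ→ℚ-* c c) ⟨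
      ℕ→ℚ (a Nat.* a) + ℕ→ℚ (b Nat.* b) + ℕ→ℚ (c Nat.* c)
        ≡⟨ ℕ→ℚ-+₃ (a Nat.* a) (b Nat.* b) (c Nat.* c) ⟨
      ℕ→ℚ (a Nat.* a Nat.+ b Nat.* b Nat.+ c Nat.* c)
        ≡⟨ cong ℕ→ℚ onQuadric ⟩
      ℕ→ℚ (3 Nat.* (d Nat.* d))
        ≡⟨ trans (ℕ→ℚ-* 3 (d Nat.* d)) (cong (three *_) (ℕ→ℚ-* d d)) ⟩
      three * (ℕ→ℚ d * ℕ→ℚ d) ∎
    a+b+c+s≡3dℚ : ℕ→ℚ a + ℕ→ℚ b + ℕ→ℚ c + ℕ→ℚ s ≡ three * ℕ→ℚ d
    a+b+c+s≡3dℚ = begin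
      ℕ→ℚ a + ℕ→ℚ b + ℕ→ℚ c + ℕ→ℚ s ≡⟨ cong (_+ ℕ→ℚ s) (ℕ→ℚ-+₃ a b c) ⟨
      ℕ→ℚ (a Nat.+ b Nat.+ c) + ℕ→ℚ s ≡⟨ ℕ→ℚ-+ (a Nat.+ b Nat.+ c) s ⟨
      ℕ→ℚ (a Nat.+ b Nat.+ c Nat.+ s) ≡⟨ cong ℕ→ℚ a+b+c+s≡3d ⟩
      ℕ→ℚ (3 Nat.* d)                 ≡⟨ ℕ→ℚ-* 3 d ⟩
      three * ℕ→ℚ d                   ∎

proposition3p1 :
  (∀ (x₁ x₂ x₃ : ℤ) →
    IntForms.A x₁ x₂ x₃ Int.* IntForms.A x₁ x₂ x₃
      Int.+ IntForms.B x₁ x₂ x₃ Int.* IntForms.B x₁ x₂ x₃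
      Int.+ IntForms.C x₁ x₂ x₃ Int.* IntForms.C x₁ x₂ x₃
      ≡ + 3 Int.* (IntForms.D x₁ x₂ x₃ Int.* IntForms.D x₁ x₂ x₃))
  ×
  (∀ (a b c d : ℕ) → 0 < a → 0 < b → 0 < c → 0 < d →
    a Nat.* a Nat.+ b Nat.* b Nat.+ c Nat.* c ≡ 3 Nat.* (d Nat.* d) →
    gcd (gcd a b) c ≡ 1 → a ≤ b → b ≤ c →
    ∃[ k ] ∃[ t₁ ] ∃[ t₂ ] ∃[ t₃ ]
      (ℕ→ℚ a ≡ ℕ→ℚ k Rat.* RatForms.A t₁ t₂ t₃ ×
       ℕ→ℚ b ≡ ℕ→ℚ k Rat.* RatForms.B t₁ t₂ t₃ ×
       ℕ→ℚ c ≡ ℕ→ℚ k Rat.* RatForms.C t₁ t₂ t₃ ×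
       ℕ→ℚ d ≡ ℕ→ℚ k Rat.* RatForms.D t₁ t₂ t₃))
proposition3p1 =
  A²+B²+C²≡3D² ,
  λ a b c d _ _ _ 0<d onQuadric _ _ _ → onQuadric⇒parametrisable a b c d 0<d onQuadric
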